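{- A characteristic Sturmian word $s=\psi(v)$ is stable if and only if its directive word $v$ is ultimately periodic.
   Context: Palindromization map on finite words: $\psi(\varepsilon)=\varepsilon$, $\psi(uz)=(\psi(u)z)^{(+)}$ ($z$ a letter, $t^{(+)}$ the shortest palindrome with prefix $t$); for infinite $v\in\{a,b\}^\omega$, $\psi(v)=\lim_n\psi(v_{[n]})$, $v_{[n]}$ the length-$n$ prefix. Characteristic Sturmian words are the words $\psi(v)$ with $v$ containing both letters infinitely often; $v$ is the (unique) directive word. Writing $v=x_0^{\alpha_0}x_1^{\alpha_1}\cdots$ ($\alpha_i\ge1$, $x_{i+1}\ne x_i$), the index of $s=\psi(v)$ is $k=\alpha_0$. Let $\mu_k:a\mapsto a^kba,\ b\mapsto a^kb$ and $\hat\mu_k:a\mapsto b^ka,\ b\mapsto b^kab$; $s$ factors uniquely over $\{a^kb,a^kba\}$ (if $s$ begins with $a$) or over $\{b^ka,b^kab\}$ (if it begins with $b$), and $Ds=\mu_k^{ -1}(s)$, resp. $\hat\mu_k^{ -1}(s)$; $Ds$ is again a characteristic Sturmian word. $D^0s=s$, $D^ps=D(D^{p-1}s)$. $s$ is stable if $D^ms=D^ns$ for some $m\neq n\ge0$. An infinite word is ultimately periodic if it equals $uz^\omega$ with $u$ finite and $z$ nonempty finite. -}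

module Defs where

open import Data.Nat using (ℕ; zero; suc; _<_; _≤_; _+_)
open import Data.List using (List; []; _∷_; _++_; _∷ʳ_; reverse; length; concatMap; concat; replicate)
open import Data.Product using (Σ; _×_; _,_; ∃)
open import Relation.Binary.PropositionalEquality using (_≡_; _≢_)
open import Function.Bundles using (_⇔_)
open import Data.Unit using (⊤)

data Letter : Set where
  a b : Letter

Word : Set
Word = List Letter

InfWord : Set
InfWord = ℕ → Letter

_≈_ : InfWord → InfWord → Set
s ≈ t = ∀ i → s i ≡ t i

take∞ : ℕ → InfWord → Word
take∞ zero    v = []
take∞ (suc n) v = v 0 ∷ take∞ n (λ i → v (suc i))

Prefix∞ : Word → InfWord → Set
Prefix∞ []      s = ⊤
Prefix∞ (x ∷ w) s = (x ≡ s 0) × Prefix∞ w (λ i → s (suc i))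

Prefix : Word → Word → Set
Prefix t p = ∃ λ r → t ++ r ≡ p

Palindrome : Word → Set
Palindrome w = reverse w ≡ w

IsPalClosure : Word → Word → Set
IsPalClosure t p =
  Palindrome p × Prefix t p ×
  (∀ q → Palindrome q → Prefix t q → length p ≤ length q)

data PsiFin : Word → Word → Set where
  psi-nil  : PsiFin [] []
  psi-snoc : ∀ {u w w′} (z : Letter) →
             PsiFin u w → IsPalClosure (w ∷ʳ z) w′ → PsiFin (u ∷ʳ z) w′

-- IsPsi v s : s = ψ(v) = lim_n ψ(v_[n]), i.e. every ψ(v_[n]) is a prefix of s
IsPsi : InfWord → InfWord → Set
IsPsi v s = ∀ n → Σ Word λ w → PsiFin (take∞ n v) w × Prefix∞ w s

BothInfinitelyOften : InfWord → Set
BothInfinitelyOften v =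
  (∀ n → ∃ λ i → n ≤ i × v i ≡ a) × (∀ n → ∃ λ i → n ≤ i × v i ≡ b)

Directive : InfWord → InfWord → Set
Directive v s = BothInfinitelyOften v × IsPsi v s

CharSturmian : InfWord → Set
CharSturmian s = ∃ λ v → Directive v s

-- v = x₀^k x₁ ... with x₁ ≠ x₀ : the first run of v has length k (= α₀)
FirstRun : InfWord → ℕ → Set
FirstRun v k = (∀ i → i < k → v i ≡ v 0) × (v k ≢ v 0)

pow : Letter → ℕ → Word
pow x zero    = []
pow x (suc n) = x ∷ pow x n

μ : ℕ → Letter → Word
μ k a = pow a k ++ (b ∷ a ∷ [])
μ k b = pow a k ++ (b ∷ [])

μ̂ : ℕ → Letter → Word
μ̂ k a = pow b k ++ (a ∷ [])
μ̂ k b = pow b k ++ (a ∷ b ∷ [])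

-- ImageUnder f t s : s = f(t) for the morphism f extended to infinite words
ImageUnder : (Letter → Word) → InfWord → InfWord → Set
ImageUnder f t s = ∀ n → Prefix∞ (concatMap f (take∞ n t)) s

-- IsD s t : t = Ds, where k is the index of s (α₀ of its directive word);
-- Ds = μ_k⁻¹(s) if s begins with a, Ds = μ̂_k⁻¹(s) if s begins with b.
MorphFor : Letter → ℕ → Letter → Word
MorphFor a k = μ k
MorphFor b k = μ̂ k

IsD : InfWord → InfWord → Set
IsD s t = ∃ λ v → ∃ λ k →
  Directive v s × FirstRun v k × ImageUnder (MorphFor (s 0) k) t s

-- s is stable: along the sequence D⁰s = s, D^{p+1}s = D(D^p s),
-- D^m s = D^n s for some m ≠ n.
Stable : InfWord → Set
Stable s = Σ (ℕ → InfWord) λ f →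
  (f 0 ≈ s) × (∀ p → IsD (f p) (f (suc p))) ×
  (∃ λ m → ∃ λ n → m ≢ n × f m ≈ f n)

-- v = u z^ω with z nonempty: every u z^n is a prefix of v
UltimatelyPeriodic : InfWord → Set
UltimatelyPeriodic v = ∃ λ u → ∃ λ z →
  (z ≢ []) × (∀ n → Prefix∞ (u ++ concat (replicate n z)) v)

-- Justin's formula ψ(xu) = μ_x(ψ(u)) x holds because w ↦ μ_x(w) x maps the palindromic closure
-- of P z to that of μ_x(P) x z; iterating it, ψ(x^k y u) begins with μ_x^k(μ_y(ψ(u))). The morphism
-- μ_x^k ∘ μ_y is μ_k (x = a) or μ̂_k (x = b), and it is injective on infinite words for k ≥ 1; hence
-- Dψ(v) = ψ(v′), where v′ is v without its first run x^k and the letter y following it. So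
-- D^p s = ψ(v from position N_p), with N_p the start of the p-th block, and since the directive word
-- is unique, D^m s = D^n s with m ≠ n holds iff v coincides with one of its proper shifts, i.e. iff v
-- is ultimately periodic; for the converse two of the N_p beyond the preperiod agree modulo the period.

module Submission where

open import Defs
open import Function.Bundles using (_⇔_; mk⇔)
open import Data.Nat using (ℕ; zero; suc; _+_; _*_; _∸_; _≤_; _<_; z≤n; s≤s; _%_; _/_)
open import Data.Nat.Properties
open import Data.Nat.DivMod using (m%n<n; m≡m%n+[m/n]*n)
open import Data.Nat.Tactic.RingSolver using (solve-∀)
open import Data.Fin using (Fin; toℕ; fromℕ<)
open import Data.Fin.Properties using (pigeonhole; toℕ-fromℕ<)
open import Data.List using ([]; _∷_; _++_; _∷ʳ_; reverse; length; concatMap; concat; replicate)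
open import Data.List.Properties using (++-assoc; length-++; reverse-++; reverse-involutive; length-reverse; ∷ʳ-injective; ++-identityʳ; unfold-reverse; ++-cancelˡ; ++-cancelʳ; ∷-injective; reverse-injective; concatMap-++)
open import Data.Product using (Σ; _×_; _,_; ∃; proj₁; proj₂)
open import Data.Sum using (_⊎_; inj₁; inj₂; [_,_]′)
open import Data.Empty using (⊥; ⊥-elim)
open import Data.Unit using (tt)
open import Relation.Binary.PropositionalEquality
open import Relation.Binary.Definitions using (tri<; tri≈; tri>)
open import Relation.Nullary using (yes; no; Dec)

-- Palindromic closure

++-≡⇒Prefix : ∀ (x c : Word) {y d : Word} → x ++ y ≡ c ++ d → length x ≤ length c → Prefix x c
++-≡⇒Prefix [] c eq le = c , refl
++-≡⇒Prefix (h ∷ x) (h′ ∷ c) eq (s≤s le) with ∷-injective eq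
... | refl , eq′ with ++-≡⇒Prefix x c eq′ le
... | r , er = r , cong (h ∷_) er

Prefix-trans : ∀ {A B C : Word} → Prefix A B → Prefix B C → Prefix A C
Prefix-trans {A} (e , refl) (f , refl) = e ++ f , sym (++-assoc A e f)

Prefix-common-≤ : ∀ {u w T : Word} → Prefix u T → Prefix w T → length u ≤ length w → Prefix u w
Prefix-common-≤ {u} {w} (e , ue) (f , wf) = ++-≡⇒Prefix u w (trans ue (sym wf))

Prefix-common-≡ : ∀ {u w T : Word} → Prefix u T → Prefix w T → length u ≡ length w → u ≡ w
Prefix-common-≡ {u} pu pw eq with Prefix-common-≤ pu pw (≤-reflexive eq)
... | [] , e = trans (sym (++-identityʳ u)) e
... | r@(_ ∷ _) , e = ⊥-elim (<-irrefl eq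
  (subst (length u <_) (trans (sym (length-++ u {r})) (cong length e)) (m<m+n (length u) (s≤s z≤n))))

length-++-cancelˡ-≤ : ∀ (T r : Word) K → length (T ++ r) ≤ length T + K → length r ≤ K
length-++-cancelˡ-≤ T r K h = +-cancelˡ-≤ (length T) _ _ (subst (_≤ length T + K) (length-++ T {r}) h)

Palindrome-++⇒reverse-Prefix : ∀ (T r : Word) → Palindrome (T ++ r) → length r ≤ length T → Prefix (reverse r) T
Palindrome-++⇒reverse-Prefix T r pal le =
  ++-≡⇒Prefix (reverse r) T (trans (sym (reverse-++ T r)) pal)
    (subst (_≤ length T) (sym (length-reverse r)) le)

reverse-++-reverse : ∀ (t Q : Word) → reverse (t ++ Q ++ reverse t) ≡ t ++ reverse Q ++ reverse t
reverse-++-reverse t Q = begin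
  reverse (t ++ Q ++ reverse t)                   ≡⟨ reverse-++ t (Q ++ reverse t) ⟩
  reverse (Q ++ reverse t) ++ reverse t           ≡⟨ cong (_++ reverse t) (reverse-++ Q (reverse t)) ⟩
  (reverse (reverse t) ++ reverse Q) ++ reverse t ≡⟨ cong (λ A → (A ++ reverse Q) ++ reverse t) (reverse-involutive t) ⟩
  (t ++ reverse Q) ++ reverse t                   ≡⟨ ++-assoc t (reverse Q) (reverse t) ⟩
  t ++ reverse Q ++ reverse t                     ∎
  where open ≡-Reasoning

Palindrome-++-reverse : ∀ (t Q : Word) → Palindrome Q → Palindrome (t ++ Q ++ reverse t)
Palindrome-++-reverse t Q palQ = trans (reverse-++-reverse t Q) (cong (λ z → t ++ z ++ reverse t) palQ)

Palindrome-++-reverse⁻¹ : ∀ (t Q : Word) → Palindrome (t ++ Q ++ reverse t) → Palindrome Q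
Palindrome-++-reverse⁻¹ t Q pal =
  ++-cancelʳ (reverse t) (reverse Q) Q (++-cancelˡ t _ _ (trans (sym (reverse-++-reverse t Q)) pal))

-- The length form of T⁽⁺⁾ = T t̃₀, where T = t₀ Q with Q the longest palindromic suffix of T.
IsPalClosureˢ : Word → Word → Set
IsPalClosureˢ T p = Palindrome p × Prefix T p ×
  (∀ t₀ Q → t₀ ++ Q ≡ T → Palindrome Q → length p ≤ length T + length t₀)

IsPalClosureˢ⇒IsPalClosure : ∀ {T p} → IsPalClosureˢ T p → IsPalClosure T p
IsPalClosureˢ⇒IsPalClosure {T} {p} (palp , Tp , bound) = palp , Tp , minimal
  where
  minimal : ∀ q → Palindrome q → Prefix T q → length p ≤ length q
  minimal q palq (r , refl) with ≤-total (length T) (length r)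
  ... | inj₁ T≤r = ≤-trans (bound T [] (++-identityʳ T) refl)
                     (≤-trans (+-monoʳ-≤ (length T) T≤r) (≤-reflexive (sym (length-++ T))))
  ... | inj₂ r≤T with Palindrome-++⇒reverse-Prefix T r palq r≤T
  ... | Q , refl = ≤-trans (bound (reverse r) Q refl palQ)
                     (≤-reflexive (trans (cong (length T +_) (length-reverse r)) (sym (length-++ T))))
    where
    q≡ : (reverse r ++ Q) ++ r ≡ reverse r ++ Q ++ reverse (reverse r)
    q≡ = trans (++-assoc (reverse r) Q r) (cong (λ z → reverse r ++ Q ++ z) (sym (reverse-involutive r)))
    palQ : Palindrome Q
    palQ = Palindrome-++-reverse⁻¹ (reverse r) Q (subst Palindrome q≡ palq)

IsPalClosure⇒IsPalClosureˢ : ∀ {T p} → IsPalClosure T p → IsPalClosureˢ T p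
IsPalClosure⇒IsPalClosureˢ {T} {p} (palp , Tp , minimal) = palp , Tp , bound
  where
  bound : ∀ t₀ Q → t₀ ++ Q ≡ T → Palindrome Q → length p ≤ length T + length t₀
  bound t₀ Q refl palQ = ≤-trans
    (minimal ((t₀ ++ Q) ++ reverse t₀)
      (subst Palindrome (sym (++-assoc t₀ Q (reverse t₀))) (Palindrome-++-reverse t₀ Q palQ))
      (reverse t₀ , refl))
    (≤-reflexive (trans (length-++ (t₀ ++ Q)) (cong (length (t₀ ++ Q) +_) (length-reverse t₀))))

IsPalClosure-unique : ∀ {T p p′} → IsPalClosure T p → IsPalClosure T p′ → p ≡ p′
IsPalClosure-unique {T} {p} {p′} c@(palp , (r , refl) , min) c′@(palp′ , (r′ , refl) , min′) =
  cong (T ++_) (reverse-injective (Prefix-common-≡ (reverse-Prefix c) (reverse-Prefix c′)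
    (trans (length-reverse r) (trans |r|≡|r′| (sym (length-reverse r′))))))
  where
  -- a closure adds at most |T| letters, so its added part is the mirror image of a prefix of T
  reverse-Prefix : ∀ {r} → IsPalClosure T (T ++ r) → Prefix (reverse r) T
  reverse-Prefix {r} cl = Palindrome-++⇒reverse-Prefix T r (proj₁ cl)
    (length-++-cancelˡ-≤ T r (length T) (proj₂ (proj₂ (IsPalClosure⇒IsPalClosureˢ cl)) T [] (++-identityʳ T) refl))
  |r|≡|r′| : length r ≡ length r′
  |r|≡|r′| = +-cancelˡ-≡ (length T) _ _ (trans (sym (length-++ T))
    (trans (≤-antisym (min (T ++ r′) palp′ (r′ , refl)) (min′ (T ++ r) palp (r , refl))) (length-++ T)))

-- Justin's morphisms and Justin's lemma

other : Letter → Letter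
other a = b
other b = a

other-≢ : ∀ x → other x ≢ x
other-≢ a ()
other-≢ b ()

≢⇒≡other : ∀ x y → y ≢ x → y ≡ other x
≢⇒≡other a a ne = ⊥-elim (ne refl)
≢⇒≡other a b ne = refl
≢⇒≡other b a ne = refl
≢⇒≡other b b ne = ⊥-elim (ne refl)

≡-or-≡other : ∀ x z → (z ≡ x) ⊎ (z ≡ other x)
≡-or-≡other a a = inj₁ refl
≡-or-≡other a b = inj₂ refl
≡-or-≡other b a = inj₂ refl
≡-or-≡other b b = inj₁ refl

-- μⱼ x is the paper's μ_x (x ↦ x, y ↦ xy); μⱼ⁺ x w = μⱼ* x w ∷ʳ x, so that ψ(xu) = μⱼ⁺ x (ψ u).
μⱼ : Letter → Letter → Word
μⱼ a a = a ∷ []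
μⱼ a b = a ∷ b ∷ []
μⱼ b a = b ∷ a ∷ []
μⱼ b b = b ∷ []

μⱼ* : Letter → Word → Word
μⱼ* x []      = []
μⱼ* x (c ∷ w) = μⱼ x c ++ μⱼ* x w

μⱼ⁺ : Letter → Word → Word
μⱼ⁺ x []      = x ∷ []
μⱼ⁺ x (c ∷ w) = μⱼ x c ++ μⱼ⁺ x w

μⱼ-self : ∀ x → μⱼ x x ≡ x ∷ []
μⱼ-self a = refl
μⱼ-self b = refl

μⱼ-other : ∀ x → μⱼ x (other x) ≡ x ∷ other x ∷ []
μⱼ-other a = refl
μⱼ-other b = refl

μⱼ-nonempty : ∀ x c → 1 ≤ length (μⱼ x c)
μⱼ-nonempty a a = s≤s z≤n
μⱼ-nonempty a b = s≤s z≤n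
μⱼ-nonempty b a = s≤s z≤n
μⱼ-nonempty b b = s≤s z≤n

∷-reverse-μⱼ : ∀ x c → x ∷ reverse (μⱼ x c) ≡ μⱼ x c ∷ʳ x
∷-reverse-μⱼ a a = refl
∷-reverse-μⱼ a b = refl
∷-reverse-μⱼ b a = refl
∷-reverse-μⱼ b b = refl

μⱼ*-++ : ∀ x u w → μⱼ* x (u ++ w) ≡ μⱼ* x u ++ μⱼ* x w
μⱼ*-++ x []      w = refl
μⱼ*-++ x (c ∷ u) w = trans (cong (μⱼ x c ++_) (μⱼ*-++ x u w)) (sym (++-assoc (μⱼ x c) (μⱼ* x u) (μⱼ* x w)))

μⱼ⁺-++ : ∀ x u w → μⱼ⁺ x (u ++ w) ≡ μⱼ* x u ++ μⱼ⁺ x w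
μⱼ⁺-++ x []      w = refl
μⱼ⁺-++ x (c ∷ u) w = trans (cong (μⱼ x c ++_) (μⱼ⁺-++ x u w)) (sym (++-assoc (μⱼ x c) (μⱼ* x u) (μⱼ⁺ x w)))

μⱼ⁺≡μⱼ*∷ʳ : ∀ x w → μⱼ⁺ x w ≡ μⱼ* x w ∷ʳ x
μⱼ⁺≡μⱼ*∷ʳ x w = trans (cong (μⱼ⁺ x) (sym (++-identityʳ w))) (μⱼ⁺-++ x w [])

μⱼ*-Prefix : ∀ x {A B} → Prefix A B → Prefix (μⱼ* x A) (μⱼ* x B)
μⱼ*-Prefix x {A} (e , refl) = μⱼ* x e , sym (μⱼ*-++ x A e)

μⱼ⁺-head : ∀ x w → ∃ λ r → μⱼ⁺ x w ≡ x ∷ r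
μⱼ⁺-head a []      = [] , refl
μⱼ⁺-head b []      = [] , refl
μⱼ⁺-head a (a ∷ w) = _ , refl
μⱼ⁺-head a (b ∷ w) = _ , refl
μⱼ⁺-head b (a ∷ w) = _ , refl
μⱼ⁺-head b (b ∷ w) = _ , refl

reverse-μⱼ⁺ : ∀ x w → reverse (μⱼ⁺ x w) ≡ μⱼ⁺ x (reverse w)
reverse-μⱼ⁺ x []      = refl
reverse-μⱼ⁺ x (c ∷ w) = begin
  reverse (μⱼ x c ++ μⱼ⁺ x w)                 ≡⟨ reverse-++ (μⱼ x c) (μⱼ⁺ x w) ⟩
  reverse (μⱼ⁺ x w) ++ reverse (μⱼ x c)       ≡⟨ cong (_++ reverse (μⱼ x c)) (reverse-μⱼ⁺ x w) ⟩
  μⱼ⁺ x (reverse w) ++ reverse (μⱼ x c)       ≡⟨ cong (_++ reverse (μⱼ x c)) (μⱼ⁺≡μⱼ*∷ʳ x (reverse w)) ⟩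
  (μⱼ* x (reverse w) ∷ʳ x) ++ reverse (μⱼ x c) ≡⟨ ++-assoc (μⱼ* x (reverse w)) _ _ ⟩
  μⱼ* x (reverse w) ++ x ∷ reverse (μⱼ x c)   ≡⟨ cong (μⱼ* x (reverse w) ++_) (∷-reverse-μⱼ x c) ⟩
  μⱼ* x (reverse w) ++ μⱼ⁺ x (c ∷ [])          ≡⟨ sym (μⱼ⁺-++ x (reverse w) (c ∷ [])) ⟩
  μⱼ⁺ x (reverse w ∷ʳ c)                      ≡⟨ cong (μⱼ⁺ x) (sym (unfold-reverse c w)) ⟩
  μⱼ⁺ x (reverse (c ∷ w))                     ∎
  where open ≡-Reasoning

length-μⱼ⁺ : ∀ x w → suc (length w) ≤ length (μⱼ⁺ x w)
length-μⱼ⁺ x []      = s≤s z≤n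
length-μⱼ⁺ x (c ∷ w) = subst (suc (suc (length w)) ≤_) (sym (length-++ (μⱼ x c)))
  (+-mono-≤ (μⱼ-nonempty x c) (length-μⱼ⁺ x w))

length-μⱼ*-reverse : ∀ x w → length (μⱼ* x (reverse w)) ≡ length (μⱼ* x w)
length-μⱼ*-reverse x w = +-cancelʳ-≡ 1 _ _ (begin
  length (μⱼ* x (reverse w)) + 1   ≡⟨ sym (length-++ (μⱼ* x (reverse w))) ⟩
  length (μⱼ* x (reverse w) ∷ʳ x)  ≡⟨ cong length (sym (trans (reverse-μⱼ⁺ x w) (μⱼ⁺≡μⱼ*∷ʳ x (reverse w)))) ⟩
  length (reverse (μⱼ⁺ x w))       ≡⟨ length-reverse (μⱼ⁺ x w) ⟩
  length (μⱼ⁺ x w)                 ≡⟨ cong length (μⱼ⁺≡μⱼ*∷ʳ x w) ⟩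
  length (μⱼ* x w ∷ʳ x)            ≡⟨ length-++ (μⱼ* x w) ⟩
  length (μⱼ* x w) + 1             ∎)
  where open ≡-Reasoning

μⱼ*-Prefix-length-≤ : ∀ x {u w} → Prefix u w → length (μⱼ* x u) ≤ length (μⱼ* x w)
μⱼ*-Prefix-length-≤ x {u} (e , refl) = ≤-trans (m≤m+n _ _)
  (≤-reflexive (trans (sym (length-++ (μⱼ* x u))) (cong length (sym (μⱼ*-++ x u e)))))

μⱼ*-∷ʳ-self : ∀ x P → μⱼ* x (P ∷ʳ x) ≡ μⱼ⁺ x P
μⱼ*-∷ʳ-self x P = begin
  μⱼ* x (P ∷ʳ x)           ≡⟨ μⱼ*-++ x P (x ∷ []) ⟩
  μⱼ* x P ++ μⱼ x x ++ []  ≡⟨ cong (λ z → μⱼ* x P ++ z ++ []) (μⱼ-self x) ⟩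
  μⱼ* x P ∷ʳ x             ≡⟨ sym (μⱼ⁺≡μⱼ*∷ʳ x P) ⟩
  μⱼ⁺ x P                  ∎
  where open ≡-Reasoning

μⱼ*-∷ʳ-other : ∀ x P → μⱼ* x (P ∷ʳ other x) ≡ μⱼ⁺ x P ∷ʳ other x
μⱼ*-∷ʳ-other x P = begin
  μⱼ* x (P ∷ʳ other x)                   ≡⟨ μⱼ*-++ x P (other x ∷ []) ⟩
  μⱼ* x P ++ μⱼ x (other x) ++ []        ≡⟨ cong (λ z → μⱼ* x P ++ z ++ []) (μⱼ-other x) ⟩
  μⱼ* x P ++ (x ∷ []) ++ (other x ∷ [])  ≡⟨ sym (++-assoc (μⱼ* x P) (x ∷ []) (other x ∷ [])) ⟩
  (μⱼ* x P ∷ʳ x) ∷ʳ other x              ≡⟨ cong (_∷ʳ other x) (sym (μⱼ⁺≡μⱼ*∷ʳ x P)) ⟩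
  μⱼ⁺ x P ∷ʳ other x                     ∎
  where open ≡-Reasoning

μⱼ⁺⁻¹ : Letter → Word → Word
μⱼ⁺⁻¹ x []            = []
μⱼ⁺⁻¹ x (_ ∷ [])      = []
μⱼ⁺⁻¹ a (_ ∷ a ∷ w)   = a ∷ μⱼ⁺⁻¹ a (a ∷ w)
μⱼ⁺⁻¹ a (_ ∷ b ∷ w)   = b ∷ μⱼ⁺⁻¹ a w
μⱼ⁺⁻¹ b (_ ∷ a ∷ w)   = a ∷ μⱼ⁺⁻¹ b w
μⱼ⁺⁻¹ b (_ ∷ b ∷ w)   = b ∷ μⱼ⁺⁻¹ b (b ∷ w)

μⱼ⁺⁻¹-μⱼ⁺ : ∀ x w → μⱼ⁺⁻¹ x (μⱼ⁺ x w) ≡ w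
μⱼ⁺⁻¹-μⱼ⁺ a [] = refl
μⱼ⁺⁻¹-μⱼ⁺ b [] = refl
μⱼ⁺⁻¹-μⱼ⁺ a (b ∷ w) = cong (b ∷_) (μⱼ⁺⁻¹-μⱼ⁺ a w)
μⱼ⁺⁻¹-μⱼ⁺ b (a ∷ w) = cong (a ∷_) (μⱼ⁺⁻¹-μⱼ⁺ b w)
μⱼ⁺⁻¹-μⱼ⁺ a (a ∷ w) with μⱼ⁺ a w | μⱼ⁺-head a w | μⱼ⁺⁻¹-μⱼ⁺ a w
... | .(a ∷ r) | r , refl | ih = cong (a ∷_) ih
μⱼ⁺⁻¹-μⱼ⁺ b (b ∷ w) with μⱼ⁺ b w | μⱼ⁺-head b w | μⱼ⁺⁻¹-μⱼ⁺ b w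
... | .(b ∷ r) | r , refl | ih = cong (b ∷_) ih

μⱼ⁺-injective : ∀ x {u w} → μⱼ⁺ x u ≡ μⱼ⁺ x w → u ≡ w
μⱼ⁺-injective x {u} {w} eq = trans (sym (μⱼ⁺⁻¹-μⱼ⁺ x u)) (trans (cong (μⱼ⁺⁻¹ x) eq) (μⱼ⁺⁻¹-μⱼ⁺ x w))

μⱼ*-injective : ∀ x {u w} → μⱼ* x u ≡ μⱼ* x w → u ≡ w
μⱼ*-injective x {u} {w} eq =
  μⱼ⁺-injective x (trans (μⱼ⁺≡μⱼ*∷ʳ x u) (trans (cong (_∷ʳ x) eq) (sym (μⱼ⁺≡μⱼ*∷ʳ x w))))

μⱼ⁺-palindrome : ∀ x {w} → Palindrome w → Palindrome (μⱼ⁺ x w)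
μⱼ⁺-palindrome x {w} pal = trans (reverse-μⱼ⁺ x w) (cong (μⱼ⁺ x) pal)

μⱼ⁺-palindrome⁻¹ : ∀ x w → Palindrome (μⱼ⁺ x w) → Palindrome w
μⱼ⁺-palindrome⁻¹ x w pal = μⱼ⁺-injective x (trans (sym (reverse-μⱼ⁺ x w)) pal)

other∷μⱼ*-palindrome⁻¹ : ∀ x W → Palindrome (other x ∷ μⱼ* x W) → Palindrome (other x ∷ W)
other∷μⱼ*-palindrome⁻¹ x W pal = μⱼ*-injective x (begin
  μⱼ* x (reverse (y ∷ W))               ≡⟨ cong (μⱼ* x) (unfold-reverse y W) ⟩
  μⱼ* x (reverse W ∷ʳ y)                ≡⟨ μⱼ*-∷ʳ-other x (reverse W) ⟩
  μⱼ⁺ x (reverse W) ∷ʳ y                ≡⟨ cong (_∷ʳ y) (sym (reverse-μⱼ⁺ x W)) ⟩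
  reverse (μⱼ⁺ x W) ∷ʳ y                ≡⟨ cong (λ z → reverse z ∷ʳ y) (μⱼ⁺≡μⱼ*∷ʳ x W) ⟩
  reverse (μⱼ* x W ∷ʳ x) ∷ʳ y           ≡⟨ cong (_∷ʳ y) (reverse-++ (μⱼ* x W) (x ∷ [])) ⟩
  x ∷ (reverse (μⱼ* x W) ∷ʳ y)          ≡⟨ cong (x ∷_) (sym (unfold-reverse y (μⱼ* x W))) ⟩
  x ∷ reverse (y ∷ μⱼ* x W)             ≡⟨ cong (x ∷_) pal ⟩
  x ∷ y ∷ μⱼ* x W                       ≡⟨ cong (_++ μⱼ* x W) (sym (μⱼ-other x)) ⟩
  μⱼ* x (y ∷ W)                         ∎)
  where
  y = other x
  open ≡-Reasoning

μⱼ⁺-cut : ∀ x W A B → μⱼ⁺ x W ≡ A ++ x ∷ B →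
  ∃ λ W₁ → ∃ λ W₂ → W ≡ W₁ ++ W₂ × A ≡ μⱼ* x W₁ × x ∷ B ≡ μⱼ⁺ x W₂
μⱼ⁺-cut x []      []               B eq = [] , [] , refl , refl , sym eq
μⱼ⁺-cut x (c ∷ W) []               B eq = [] , c ∷ W , refl , refl , sym eq
μⱼ⁺-cut x []      (_ ∷ [])         B ()
μⱼ⁺-cut x []      (_ ∷ _ ∷ _)      B ()
μⱼ⁺-cut a (b ∷ W) (_ ∷ [])         B ()
μⱼ⁺-cut b (a ∷ W) (_ ∷ [])         B ()
μⱼ⁺-cut a (a ∷ W) (_ ∷ A)          B eq with ∷-injective eq
... | refl , eq′ with μⱼ⁺-cut a W A B eq′
... | W₁ , W₂ , e₁ , e₂ , e₃ = a ∷ W₁ , W₂ , cong (a ∷_) e₁ , cong (a ∷_) e₂ , e₃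
μⱼ⁺-cut b (b ∷ W) (_ ∷ A)          B eq with ∷-injective eq
... | refl , eq′ with μⱼ⁺-cut b W A B eq′
... | W₁ , W₂ , e₁ , e₂ , e₃ = b ∷ W₁ , W₂ , cong (b ∷_) e₁ , cong (b ∷_) e₂ , e₃
μⱼ⁺-cut a (b ∷ W) (_ ∷ _ ∷ A)      B eq with ∷-injective eq
... | refl , eq₁ with ∷-injective eq₁
... | refl , eq′ with μⱼ⁺-cut a W A B eq′
... | W₁ , W₂ , e₁ , e₂ , e₃ = b ∷ W₁ , W₂ , cong (b ∷_) e₁ , cong (λ z → a ∷ b ∷ z) e₂ , e₃
μⱼ⁺-cut b (a ∷ W) (_ ∷ _ ∷ A)      B eq with ∷-injective eq
... | refl , eq₁ with ∷-injective eq₁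
... | refl , eq′ with μⱼ⁺-cut b W A B eq′
... | W₁ , W₂ , e₁ , e₂ , e₃ = a ∷ W₁ , W₂ , cong (a ∷_) e₁ , cong (λ z → b ∷ a ∷ z) e₂ , e₃

μⱼ*-cut-other : ∀ x W A B → μⱼ* x W ≡ A ++ other x ∷ B →
  ∃ λ W₁ → ∃ λ W₂ → W ≡ W₁ ++ other x ∷ W₂ × A ≡ μⱼ* x W₁ ∷ʳ x × B ≡ μⱼ* x W₂
μⱼ*-cut-other x [] []      B ()
μⱼ*-cut-other x [] (_ ∷ A) B ()
μⱼ*-cut-other a (a ∷ W) [] B ()
μⱼ*-cut-other b (b ∷ W) [] B ()
μⱼ*-cut-other a (b ∷ W) [] B ()
μⱼ*-cut-other b (a ∷ W) [] B ()
μⱼ*-cut-other a (a ∷ W) (_ ∷ A) B eq with ∷-injective eq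
... | refl , eq′ with μⱼ*-cut-other a W A B eq′
... | W₁ , W₂ , e₁ , e₂ , e₃ = a ∷ W₁ , W₂ , cong (a ∷_) e₁ , cong (a ∷_) e₂ , e₃
μⱼ*-cut-other b (b ∷ W) (_ ∷ A) B eq with ∷-injective eq
... | refl , eq′ with μⱼ*-cut-other b W A B eq′
... | W₁ , W₂ , e₁ , e₂ , e₃ = b ∷ W₁ , W₂ , cong (b ∷_) e₁ , cong (b ∷_) e₂ , e₃
μⱼ*-cut-other a (b ∷ W) (_ ∷ []) B eq with ∷-injective eq
... | refl , eq₁ with ∷-injective eq₁
... | refl , eq₂ = [] , W , refl , refl , sym eq₂
μⱼ*-cut-other b (a ∷ W) (_ ∷ []) B eq with ∷-injective eq
... | refl , eq₁ with ∷-injective eq₁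
... | refl , eq₂ = [] , W , refl , refl , sym eq₂
μⱼ*-cut-other a (b ∷ W) (_ ∷ _ ∷ A) B eq with ∷-injective eq
... | refl , eq₁ with ∷-injective eq₁
... | refl , eq′ with μⱼ*-cut-other a W A B eq′
... | W₁ , W₂ , e₁ , e₂ , e₃ = b ∷ W₁ , W₂ , cong (b ∷_) e₁ , cong (λ z → a ∷ b ∷ z) e₂ , e₃
μⱼ*-cut-other b (a ∷ W) (_ ∷ _ ∷ A) B eq with ∷-injective eq
... | refl , eq₁ with ∷-injective eq₁
... | refl , eq′ with μⱼ*-cut-other b W A B eq′
... | W₁ , W₂ , e₁ , e₂ , e₃ = a ∷ W₁ , W₂ , cong (a ∷_) e₁ , cong (λ z → b ∷ a ∷ z) e₂ , e₃

Palindrome-suffix-head : ∀ (t Q L : Word) q e → t ++ q ∷ Q ≡ L ∷ʳ e → Palindrome (q ∷ Q) → q ≡ e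
Palindrome-suffix-head t Q L q e eq pal = proj₂ (∷ʳ-injective (t ++ reverse Q) L
  (trans (++-assoc t (reverse Q) (q ∷ [])) (trans (cong (t ++_) (trans (sym (unfold-reverse q Q)) pal)) eq)))

module ClosureImage (x : Letter) (T r : Word) (palTr : Palindrome (T ++ r))
  (bound : ∀ t₀ Q → t₀ ++ Q ≡ T → Palindrome Q → length (T ++ r) ≤ length T + length t₀) where

  |r|≤|T| : length r ≤ length T
  |r|≤|T| = length-++-cancelˡ-≤ T r (length T) (bound T [] (++-identityʳ T) refl)

  length-μⱼ⁺-Tr : length (μⱼ⁺ x (T ++ r)) ≡ length (μⱼ* x T) + (length (μⱼ* x r) + 1)
  length-μⱼ⁺-Tr = begin
    length (μⱼ⁺ x (T ++ r))                  ≡⟨ cong length (μⱼ⁺-++ x T r) ⟩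
    length (μⱼ* x T ++ μⱼ⁺ x r)              ≡⟨ length-++ (μⱼ* x T) ⟩
    length (μⱼ* x T) + length (μⱼ⁺ x r)      ≡⟨ cong (λ w → length (μⱼ* x T) + length w) (μⱼ⁺≡μⱼ*∷ʳ x r) ⟩
    length (μⱼ* x T) + length (μⱼ* x r ∷ʳ x) ≡⟨ cong (length (μⱼ* x T) +_) (length-++ (μⱼ* x r)) ⟩
    length (μⱼ* x T) + (length (μⱼ* x r) + 1) ∎
    where open ≡-Reasoning

  μⱼ*-r-≤-Prefix : ∀ W₁ → Prefix W₁ T → length r ≤ length W₁ → length (μⱼ* x r) ≤ length (μⱼ* x W₁)
  μⱼ*-r-≤-Prefix W₁ W₁T r≤W₁ = subst (_≤ length (μⱼ* x W₁)) (length-μⱼ*-reverse x r)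
    (μⱼ*-Prefix-length-≤ x (Prefix-common-≤ (Palindrome-++⇒reverse-Prefix T r palTr |r|≤|T|) W₁T
      (subst (_≤ length W₁) (sym (length-reverse r)) r≤W₁)))

  μⱼ*-r-≤-cut : ∀ W₁ W₂ → T ≡ W₁ ++ W₂ → Palindrome W₂ → length (μⱼ* x r) ≤ length (μⱼ* x W₁)
  μⱼ*-r-≤-cut W₁ W₂ e pal =
    μⱼ*-r-≤-Prefix W₁ (W₂ , sym e) (length-++-cancelˡ-≤ T r (length W₁) (bound W₁ W₂ (sym e) pal))

μⱼ⁺-closure-self : ∀ x P p → IsPalClosureˢ (P ∷ʳ x) p → IsPalClosureˢ (μⱼ⁺ x P ∷ʳ x) (μⱼ⁺ x p)
μⱼ⁺-closure-self x P .((P ∷ʳ x) ++ r) (palp , (r , refl) , bound) = μⱼ⁺-palindrome x palp , prefix , bound′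
  where
  T = P ∷ʳ x
  T′ = μⱼ⁺ x P ∷ʳ x
  p′ = μⱼ⁺ x (T ++ r)
  open ClosureImage x T r palp bound
  T′≡ : T′ ≡ μⱼ* x T ∷ʳ x
  T′≡ = cong (_∷ʳ x) (sym (μⱼ*-∷ʳ-self x P))
  |T′|≡ : length T′ ≡ length (μⱼ* x T) + 1
  |T′|≡ = trans (cong length T′≡) (length-++ (μⱼ* x T))
  prefix : Prefix T′ p′
  prefix with μⱼ⁺ x r | μⱼ⁺-head x r | μⱼ⁺-++ x T r
  ... | .(x ∷ R) | R , refl | e = R , trans (cong (_++ R) T′≡) (trans (++-assoc (μⱼ* x T) (x ∷ []) R) (sym e))
  from-μⱼ*-r : ∀ t₀ → length (μⱼ* x r) ≤ length t₀ → length p′ ≤ length T′ + length t₀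
  from-μⱼ*-r t₀ le = subst₂ _≤_ (sym length-μⱼ⁺-Tr) (cong (_+ length t₀) (sym |T′|≡)) (begin
    length (μⱼ* x T) + (length (μⱼ* x r) + 1) ≡⟨ cong (length (μⱼ* x T) +_) (+-comm _ 1) ⟩
    length (μⱼ* x T) + (1 + length (μⱼ* x r)) ≡⟨ +-assoc (length (μⱼ* x T)) 1 _ ⟨
    length (μⱼ* x T) + 1 + length (μⱼ* x r)   ≤⟨ +-monoʳ-≤ (length (μⱼ* x T) + 1) le ⟩
    length (μⱼ* x T) + 1 + length t₀          ∎)
    where open ≤-Reasoning
  bound′ : ∀ t₀ Q → t₀ ++ Q ≡ T′ → Palindrome Q → length p′ ≤ length T′ + length t₀
  bound′ t₀ [] e _ = from-μⱼ*-r t₀ (begin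
    length (μⱼ* x r)      ≤⟨ μⱼ*-r-≤-Prefix T ([] , ++-identityʳ T) |r|≤|T| ⟩
    length (μⱼ* x T)      ≤⟨ m≤m+n _ 1 ⟩
    length (μⱼ* x T) + 1  ≡⟨ |T′|≡ ⟨
    length T′             ≡⟨ cong length (trans (sym (++-identityʳ t₀)) e) ⟨
    length t₀             ∎)
    where open ≤-Reasoning
  bound′ t₀ (q ∷ Q) e palQ with Palindrome-suffix-head t₀ Q (μⱼ* x T) q x (trans e T′≡) palQ
  ... | refl with μⱼ⁺-cut x T t₀ Q (trans (μⱼ⁺≡μⱼ*∷ʳ x T) (sym (trans e T′≡)))
  ... | W₁ , W₂ , e₁ , refl , e₃ = from-μⱼ*-r (μⱼ* x W₁)
    (μⱼ*-r-≤-cut W₁ W₂ e₁ (μⱼ⁺-palindrome⁻¹ x W₂ (subst Palindrome e₃ palQ)))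

μⱼ⁺-closure-other : ∀ x P p → IsPalClosureˢ (P ∷ʳ other x) p → IsPalClosureˢ (μⱼ⁺ x P ∷ʳ other x) (μⱼ⁺ x p)
μⱼ⁺-closure-other x P .((P ∷ʳ other x) ++ r) (palp , (r , refl) , bound) = μⱼ⁺-palindrome x palp , prefix , bound′
  where
  y = other x
  T = P ∷ʳ y
  T′ = μⱼ⁺ x P ∷ʳ y
  p′ = μⱼ⁺ x (T ++ r)
  open ClosureImage x T r palp bound
  T′≡ : T′ ≡ μⱼ* x T
  T′≡ = sym (μⱼ*-∷ʳ-other x P)
  prefix : Prefix T′ p′
  prefix = μⱼ⁺ x r , trans (cong (_++ μⱼ⁺ x r) T′≡) (sym (μⱼ⁺-++ x T r))
  from-μⱼ*-r : ∀ t₀ → length (μⱼ* x r) + 1 ≤ length t₀ → length p′ ≤ length T′ + length t₀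
  from-μⱼ*-r t₀ le = subst₂ _≤_ (sym length-μⱼ⁺-Tr) (cong (λ w → length w + length t₀) (sym T′≡))
    (+-monoʳ-≤ (length (μⱼ* x T)) le)
  bound′ : ∀ t₀ Q → t₀ ++ Q ≡ T′ → Palindrome Q → length p′ ≤ length T′ + length t₀
  bound′ t₀ [] e _ = from-μⱼ*-r t₀ (begin
    length (μⱼ* x r) + 1        ≤⟨ +-monoˡ-≤ 1 (μⱼ*-r-≤-Prefix P (y ∷ [] , refl) |r|≤|P|) ⟩
    length (μⱼ* x P) + 1        ≤⟨ m≤m+n _ 1 ⟩
    length (μⱼ* x P) + 1 + 1    ≡⟨ cong (_+ 1) (length-++ (μⱼ* x P)) ⟨
    length (μⱼ* x P ∷ʳ x) + 1   ≡⟨ cong (λ w → length w + 1) (μⱼ⁺≡μⱼ*∷ʳ x P) ⟨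
    length (μⱼ⁺ x P) + 1        ≡⟨ length-++ (μⱼ⁺ x P) ⟨
    length T′                   ≡⟨ cong length (trans (sym (++-identityʳ t₀)) e) ⟨
    length t₀                   ∎)
    where
    open ≤-Reasoning
    |r|≤|P| : length r ≤ length P
    |r|≤|P| = length-++-cancelˡ-≤ T r (length P) (bound P (y ∷ []) refl refl)
  bound′ t₀ (q ∷ Q) e palQ with Palindrome-suffix-head t₀ Q (μⱼ⁺ x P) q y e palQ
  ... | refl with μⱼ*-cut-other x T t₀ Q (sym (trans e T′≡))
  ... | W₁ , W₂ , e₁ , refl , refl = from-μⱼ*-r (μⱼ* x W₁ ∷ʳ x) (begin
    length (μⱼ* x r) + 1       ≤⟨ +-monoˡ-≤ 1 (μⱼ*-r-≤-cut W₁ (y ∷ W₂) e₁ (other∷μⱼ*-palindrome⁻¹ x W₂ palQ)) ⟩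
    length (μⱼ* x W₁) + 1      ≡⟨ length-++ (μⱼ* x W₁) ⟨
    length (μⱼ* x W₁ ∷ʳ x)     ∎)
    where open ≤-Reasoning

μⱼ⁺-closure : ∀ x P z p → IsPalClosureˢ (P ∷ʳ z) p → IsPalClosureˢ (μⱼ⁺ x P ∷ʳ z) (μⱼ⁺ x p)
μⱼ⁺-closure x P z p cl with ≡-or-≡other x z
... | inj₁ refl = μⱼ⁺-closure-self x P p cl
... | inj₂ refl = μⱼ⁺-closure-other x P p cl

ψ : Word → Word
ψ []      = []
ψ (c ∷ w) = μⱼ⁺ c (ψ w)

ψ-∷ʳ-IsPalClosureˢ : ∀ u z → IsPalClosureˢ (ψ u ∷ʳ z) (ψ (u ∷ʳ z))
ψ-∷ʳ-IsPalClosureˢ []      z = refl , ([] , refl) , (λ _ _ _ _ → s≤s z≤n)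
ψ-∷ʳ-IsPalClosureˢ (c ∷ u) z = μⱼ⁺-closure c (ψ u) z (ψ (u ∷ʳ z)) (ψ-∷ʳ-IsPalClosureˢ u z)

ψ-∷ʳ-IsPalClosure : ∀ u z → IsPalClosure (ψ u ∷ʳ z) (ψ (u ∷ʳ z))
ψ-∷ʳ-IsPalClosure u z = IsPalClosureˢ⇒IsPalClosure (ψ-∷ʳ-IsPalClosureˢ u z)

PsiFin⇒≡ψ : ∀ {u w} → PsiFin u w → w ≡ ψ u
PsiFin⇒≡ψ psi-nil = refl
PsiFin⇒≡ψ (psi-snoc {u} z pf cl) with PsiFin⇒≡ψ pf
... | refl = IsPalClosure-unique cl (ψ-∷ʳ-IsPalClosure u z)

ψ-∷ʳ-Prefix : ∀ u z → Prefix (ψ u ∷ʳ z) (ψ (u ∷ʳ z))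
ψ-∷ʳ-Prefix u z = proj₁ (proj₂ (ψ-∷ʳ-IsPalClosure u z))

length-ψ : ∀ u → length u ≤ length (ψ u)
length-ψ []      = z≤n
length-ψ (c ∷ u) = ≤-trans (s≤s (length-ψ u)) (length-μⱼ⁺ c (ψ u))

-- Infinite words and their palindromization

drop∞ : ℕ → InfWord → InfWord
drop∞ m s i = s (m + i)

drop∞-drop∞ : ∀ m n v → drop∞ n (drop∞ m v) ≈ drop∞ (m + n) v
drop∞-drop∞ m n v i = cong v (sym (+-assoc m n i))

-- the letter a is a junk value beyond the end of the word
nth : Word → ℕ → Letter
nth []      i       = a
nth (c ∷ w) zero    = c
nth (c ∷ w) (suc i) = nth w i

nth-∷ʳ-length : ∀ (A : Word) z → nth (A ∷ʳ z) (length A) ≡ z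
nth-∷ʳ-length []      z = refl
nth-∷ʳ-length (c ∷ A) z = nth-∷ʳ-length A z

nth-Prefix : ∀ {A B : Word} i → Prefix A B → i < length A → nth A i ≡ nth B i
nth-Prefix {c ∷ A} zero    (e , refl) lt       = refl
nth-Prefix {c ∷ A} (suc i) (e , refl) (s≤s lt) = nth-Prefix {A} i (e , refl) lt

Prefix∞⇒nth : ∀ W s → Prefix∞ W s → ∀ i → i < length W → nth W i ≡ s i
Prefix∞⇒nth (c ∷ W) s (e , p) zero    lt       = e
Prefix∞⇒nth (c ∷ W) s (e , p) (suc i) (s≤s lt) = Prefix∞⇒nth W (λ j → s (suc j)) p i lt

nth⇒Prefix∞ : ∀ W s → (∀ i → i < length W → nth W i ≡ s i) → Prefix∞ W s
nth⇒Prefix∞ []      s h = tt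
nth⇒Prefix∞ (c ∷ W) s h = h 0 (s≤s z≤n) , nth⇒Prefix∞ W (λ j → s (suc j)) (λ i lt → h (suc i) (s≤s lt))

Prefix∞-resp-≈ : ∀ W {s s′} → Prefix∞ W s → s ≈ s′ → Prefix∞ W s′
Prefix∞-resp-≈ []      p e = tt
Prefix∞-resp-≈ (c ∷ W) (e₀ , p) e = trans e₀ (e 0) , Prefix∞-resp-≈ W p (λ i → e (suc i))

Prefix∞-++⁻ˡ : ∀ A B s → Prefix∞ (A ++ B) s → Prefix∞ A s
Prefix∞-++⁻ˡ []      B s p       = tt
Prefix∞-++⁻ˡ (c ∷ A) B s (e , p) = e , Prefix∞-++⁻ˡ A B _ p

Prefix∞-++⁻ʳ : ∀ A B s → Prefix∞ (A ++ B) s → Prefix∞ B (drop∞ (length A) s)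
Prefix∞-++⁻ʳ []      B s p       = p
Prefix∞-++⁻ʳ (c ∷ A) B s (e , p) = Prefix∞-++⁻ʳ A B (λ i → s (suc i)) p

Prefix∞-++⁺ : ∀ A B s → Prefix∞ A s → Prefix∞ B (drop∞ (length A) s) → Prefix∞ (A ++ B) s
Prefix∞-++⁺ []      B s p       q = q
Prefix∞-++⁺ (c ∷ A) B s (e , p) q = e , Prefix∞-++⁺ A B _ p q

Prefix∞-Prefix : ∀ {A B} s → Prefix A B → Prefix∞ B s → Prefix∞ A s
Prefix∞-Prefix {A} s (e , refl) = Prefix∞-++⁻ˡ A e s

Prefix∞-take∞ : ∀ n s → Prefix∞ (take∞ n s) s
Prefix∞-take∞ zero    s = tt
Prefix∞-take∞ (suc n) s = refl , Prefix∞-take∞ n _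

Prefix∞⇒take∞-Prefix : ∀ W s n → Prefix∞ W s → n ≤ length W → Prefix (take∞ n s) W
Prefix∞⇒take∞-Prefix W       s zero    p       le       = W , refl
Prefix∞⇒take∞-Prefix (c ∷ W) s (suc n) (e , p) (s≤s le) with Prefix∞⇒take∞-Prefix W _ n p le
... | r , eq = r , cong₂ _∷_ (sym e) eq

length-take∞ : ∀ n s → length (take∞ n s) ≡ n
length-take∞ zero    s = refl
length-take∞ (suc n) s = cong suc (length-take∞ n _)

take∞-cong : ∀ n {s s′} → s ≈ s′ → take∞ n s ≡ take∞ n s′
take∞-cong zero    e = refl
take∞-cong (suc n) e = cong₂ _∷_ (e 0) (take∞-cong n (λ i → e (suc i)))

take∞-suc : ∀ n s → take∞ (suc n) s ≡ take∞ n s ∷ʳ s n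
take∞-suc zero    s = refl
take∞-suc (suc n) s = cong (s 0 ∷_) (take∞-suc n (λ i → s (suc i)))

take∞-+ : ∀ m n s → take∞ (m + n) s ≡ take∞ m s ++ take∞ n (drop∞ m s)
take∞-+ zero    n s = refl
take∞-+ (suc m) n s = cong (s 0 ∷_) (take∞-+ m n (λ i → s (suc i)))

≈-by-take∞-induction : ∀ {t t′} → (∀ n → take∞ n t ≡ take∞ n t′ → t n ≡ t′ n) → t ≈ t′
≈-by-take∞-induction {t} {t′} step i = step i (take∞-≡ i)
  where
  take∞-≡ : ∀ n → take∞ n t ≡ take∞ n t′
  take∞-≡ zero    = refl
  take∞-≡ (suc n) = trans (take∞-suc n t)
    (trans (cong₂ _∷ʳ_ (take∞-≡ n) (step n (take∞-≡ n))) (sym (take∞-suc n t′)))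

ψ-take∞-mono : ∀ v n m → n ≤ m → Prefix (ψ (take∞ n v)) (ψ (take∞ m v))
ψ-take∞-mono v n zero    z≤n = [] , refl
ψ-take∞-mono v n (suc m) le with m≤n⇒m<n∨m≡n le
... | inj₂ refl       = [] , ++-identityʳ _
... | inj₁ (s≤s n≤m) = Prefix-trans (ψ-take∞-mono v n m n≤m)
  (subst (λ u → Prefix (ψ (take∞ m v)) (ψ u)) (sym (take∞-suc m v))
    (Prefix-trans (v m ∷ [] , refl) (ψ-∷ʳ-Prefix (take∞ m v) (v m))))

PsiFin-ψ-take∞ : ∀ n v → PsiFin (take∞ n v) (ψ (take∞ n v))
PsiFin-ψ-take∞ zero    v = psi-nil
PsiFin-ψ-take∞ (suc n) v = subst (λ u → PsiFin u (ψ u)) (sym (take∞-suc n v))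
  (psi-snoc (v n) (PsiFin-ψ-take∞ n v) (ψ-∷ʳ-IsPalClosure (take∞ n v) (v n)))

length-ψ-take∞ : ∀ n v → n ≤ length (ψ (take∞ n v))
length-ψ-take∞ n v = subst (_≤ length (ψ (take∞ n v))) (length-take∞ n v) (length-ψ (take∞ n v))

ψ∞ : InfWord → InfWord
ψ∞ v i = nth (ψ (take∞ (suc i) v)) i

ψ∞-cong : ∀ {v v′} → v ≈ v′ → ψ∞ v ≈ ψ∞ v′
ψ∞-cong e i = cong (λ u → nth (ψ u) i) (take∞-cong (suc i) e)

Prefix∞-ψ∞ : ∀ v n → Prefix∞ (ψ (take∞ n v)) (ψ∞ v)
Prefix∞-ψ∞ v n = nth⇒Prefix∞ _ _ λ i lt →
  trans (nth-Prefix i (ψ-take∞-mono v n (n + suc i) (m≤m+n n (suc i))) lt)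
    (sym (nth-Prefix i (ψ-take∞-mono v (suc i) (n + suc i) (m≤n+m (suc i) n)) (length-ψ-take∞ (suc i) v)))

IsPsi-ψ∞ : ∀ v → IsPsi v (ψ∞ v)
IsPsi-ψ∞ v n = ψ (take∞ n v) , PsiFin-ψ-take∞ n v , Prefix∞-ψ∞ v n

IsPsi⇒Prefix∞ : ∀ {v s} → IsPsi v s → ∀ n → Prefix∞ (ψ (take∞ n v)) s
IsPsi⇒Prefix∞ {v} {s} h n with h n
... | w , pf , p = subst (λ z → Prefix∞ z s) (PsiFin⇒≡ψ pf) p

IsPsi-unique : ∀ {v s s′} → IsPsi v s → IsPsi v s′ → s ≈ s′
IsPsi-unique {v} {s} {s′} h h′ i =
  trans (sym (Prefix∞⇒nth _ s (IsPsi⇒Prefix∞ h (suc i)) i (length-ψ-take∞ (suc i) v)))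
        (Prefix∞⇒nth _ s′ (IsPsi⇒Prefix∞ h′ (suc i)) i (length-ψ-take∞ (suc i) v))

IsPsi-respʳ-≈ : ∀ {v s s′} → s ≈ s′ → IsPsi v s → IsPsi v s′
IsPsi-respʳ-≈ e h n with h n
... | w , pf , p = w , pf , Prefix∞-resp-≈ w p e

IsPsi-respˡ-≈ : ∀ {v v′ s} → v ≈ v′ → IsPsi v s → IsPsi v′ s
IsPsi-respˡ-≈ e h n with h n
... | w , pf , p = w , subst (λ u → PsiFin u w) (take∞-cong n e) pf , p

IsPsi⇒letter-after-ψ : ∀ {v s} → IsPsi v s → ∀ n → s (length (ψ (take∞ n v))) ≡ v n
IsPsi⇒letter-after-ψ {v} {s} h n = trans (sym (Prefix∞⇒nth _ s prefix (length U) lt)) (nth-∷ʳ-length U (v n))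
  where
  U = ψ (take∞ n v)
  prefix : Prefix∞ (U ∷ʳ v n) s
  prefix = Prefix∞-Prefix s (subst (λ u → Prefix (U ∷ʳ v n) (ψ u)) (sym (take∞-suc n v))
             (ψ-∷ʳ-Prefix (take∞ n v) (v n))) (IsPsi⇒Prefix∞ h (suc n))
  lt : length U < length (U ∷ʳ v n)
  lt = subst (length U <_) (sym (length-++ U)) (m<m+n (length U) (s≤s z≤n))

IsPsi-directive-unique : ∀ {w w′ s} → IsPsi w s → IsPsi w′ s → w ≈ w′
IsPsi-directive-unique {s = s} h h′ = ≈-by-take∞-induction λ n eq →
  trans (sym (IsPsi⇒letter-after-ψ h n)) (trans (cong (λ u → s (length (ψ u))) eq) (IsPsi⇒letter-after-ψ h′ n))

IsPsi-head : ∀ {v s} → IsPsi v s → s 0 ≡ v 0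
IsPsi-head h = sym (proj₁ (IsPsi⇒Prefix∞ h 1))

-- The operator D through iterated Justin morphisms

μⱼ^ : Letter → ℕ → Word → Word
μⱼ^ x zero    w = w
μⱼ^ x (suc k) w = μⱼ* x (μⱼ^ x k w)

μⱼ^-++ : ∀ x k u w → μⱼ^ x k (u ++ w) ≡ μⱼ^ x k u ++ μⱼ^ x k w
μⱼ^-++ x zero    u w = refl
μⱼ^-++ x (suc k) u w = trans (cong (μⱼ* x) (μⱼ^-++ x k u w)) (μⱼ*-++ x (μⱼ^ x k u) (μⱼ^ x k w))

μⱼ^-[] : ∀ x k → μⱼ^ x k [] ≡ []
μⱼ^-[] x zero    = refl
μⱼ^-[] x (suc k) = cong (μⱼ* x) (μⱼ^-[] x k)

μⱼ^-self : ∀ x k → μⱼ^ x k (x ∷ []) ≡ x ∷ []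
μⱼ^-self x zero    = refl
μⱼ^-self x (suc k) = trans (cong (μⱼ* x) (μⱼ^-self x k)) (cong (_++ []) (μⱼ-self x))

μⱼ*-pow : ∀ x k → μⱼ* x (pow x k) ≡ pow x k
μⱼ*-pow x zero    = refl
μⱼ*-pow x (suc k) = trans (cong (_++ μⱼ* x (pow x k)) (μⱼ-self x)) (cong (x ∷_) (μⱼ*-pow x k))

pow-++-∷ : ∀ x k (r : Word) → pow x k ++ x ∷ r ≡ x ∷ (pow x k ++ r)
pow-++-∷ x zero    r = refl
pow-++-∷ x (suc k) r = cong (x ∷_) (pow-++-∷ x k r)

μⱼ^-other : ∀ x k → μⱼ^ x k (other x ∷ []) ≡ pow x k ∷ʳ other x
μⱼ^-other x zero    = refl
μⱼ^-other x (suc k) = begin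
  μⱼ* x (μⱼ^ x k (other x ∷ []))               ≡⟨ cong (μⱼ* x) (μⱼ^-other x k) ⟩
  μⱼ* x (pow x k ∷ʳ other x)                   ≡⟨ μⱼ*-++ x (pow x k) (other x ∷ []) ⟩
  μⱼ* x (pow x k) ++ (μⱼ x (other x) ++ [])    ≡⟨ cong₂ (λ A B → A ++ (B ++ [])) (μⱼ*-pow x k) (μⱼ-other x) ⟩
  pow x k ++ x ∷ other x ∷ []                  ≡⟨ pow-++-∷ x k (other x ∷ []) ⟩
  x ∷ (pow x k ∷ʳ other x)                     ∎
  where open ≡-Reasoning

-- μ_x^k ∘ μ_y is the paper's μ_k when x = a and μ̂_k when x = b.
μⱼ^-μⱼ-other : ∀ x k c → μⱼ^ x k (μⱼ (other x) c) ≡ MorphFor x k c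
μⱼ^-μⱼ-other a k a = trans (μⱼ^-++ a k (b ∷ []) (a ∷ []))
  (trans (cong₂ _++_ (μⱼ^-other a k) (μⱼ^-self a k)) (++-assoc (pow a k) (b ∷ []) (a ∷ [])))
μⱼ^-μⱼ-other a k b = μⱼ^-other a k
μⱼ^-μⱼ-other b k a = μⱼ^-other b k
μⱼ^-μⱼ-other b k b = trans (μⱼ^-++ b k (a ∷ []) (b ∷ []))
  (trans (cong₂ _++_ (μⱼ^-other b k) (μⱼ^-self b k)) (++-assoc (pow b k) (a ∷ []) (b ∷ [])))

μⱼ^-μⱼ*-other : ∀ x k W → μⱼ^ x k (μⱼ* (other x) W) ≡ concatMap (MorphFor x k) W
μⱼ^-μⱼ*-other x k []      = μⱼ^-[] x k
μⱼ^-μⱼ*-other x k (c ∷ W) = trans (μⱼ^-++ x k (μⱼ (other x) c) (μⱼ* (other x) W))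
  (cong₂ _++_ (μⱼ^-μⱼ-other x k c) (μⱼ^-μⱼ*-other x k W))

concatMap-Prefix : ∀ (f : Letter → Word) {A B} → Prefix A B → Prefix (concatMap f A) (concatMap f B)
concatMap-Prefix f {A} (e , refl) = concatMap f e , sym (concatMap-++ f A e)

μⱼ^-μⱼ*-ψ-Prefix : ∀ x k y W → Prefix (μⱼ^ x k (μⱼ* y (ψ W))) (ψ (pow x k ++ y ∷ W))
μⱼ^-μⱼ*-ψ-Prefix x zero    y W = y ∷ [] , sym (μⱼ⁺≡μⱼ*∷ʳ y (ψ W))
μⱼ^-μⱼ*-ψ-Prefix x (suc k) y W = Prefix-trans (μⱼ*-Prefix x (μⱼ^-μⱼ*-ψ-Prefix x k y W))
  (x ∷ [] , sym (μⱼ⁺≡μⱼ*∷ʳ x (ψ (pow x k ++ y ∷ W))))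

take∞-pow : ∀ k v x → (∀ i → i < k → v i ≡ x) → take∞ k v ≡ pow x k
take∞-pow zero    v x h = refl
take∞-pow (suc k) v x h = cong₂ _∷_ (h 0 (s≤s z≤n)) (take∞-pow k (λ i → v (suc i)) x (λ i lt → h (suc i) (s≤s lt)))

take∞-FirstRun : ∀ v k n → FirstRun v k → take∞ (k + suc n) v ≡ pow (v 0) k ++ other (v 0) ∷ take∞ n (drop∞ (suc k) v)
take∞-FirstRun v k n (run , end) = trans (take∞-+ k (suc n) v)
  (cong₂ _++_ (take∞-pow k v (v 0) run)
    (cong₂ _∷_ (trans (cong v (+-identityʳ k)) (≢⇒≡other (v 0) (v k) end))
               (take∞-cong n (λ i → cong v (+-suc k i)))))

ψ∞-ImageUnder : ∀ v s k → IsPsi v s → FirstRun v k → ImageUnder (MorphFor (v 0) k) (ψ∞ (drop∞ (suc k) v)) s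
ψ∞-ImageUnder v s k h fr n = Prefix∞-Prefix s prefix (IsPsi⇒Prefix∞ h (k + suc n))
  where
  x = v 0
  v′ = drop∞ (suc k) v
  W = take∞ n v′
  F = MorphFor x k
  prefix : Prefix (concatMap F (take∞ n (ψ∞ v′))) (ψ (take∞ (k + suc n) v))
  prefix = Prefix-trans
    (concatMap-Prefix F (Prefix∞⇒take∞-Prefix (ψ W) (ψ∞ v′) n (Prefix∞-ψ∞ v′ n) (length-ψ-take∞ n v′)))
    (subst₂ Prefix (μⱼ^-μⱼ*-other x k (ψ W)) (cong ψ (sym (take∞-FirstRun v k n fr)))
      (μⱼ^-μⱼ*-ψ-Prefix x k (other x) W))

MorphFor-starts : ∀ x k c → ∃ λ E → MorphFor x k c ≡ pow x k ++ other x ∷ E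
MorphFor-starts a k a = _ , refl
MorphFor-starts a k b = _ , refl
MorphFor-starts b k a = _ , refl
MorphFor-starts b k b = _ , refl

MorphFor-cases : ∀ x k c → (c ≡ x × MorphFor x k c ≡ pow x k ++ other x ∷ x ∷ [])
                         ⊎ (c ≡ other x × MorphFor x k c ≡ pow x k ++ other x ∷ [])
MorphFor-cases a k a = inj₁ (refl , refl)
MorphFor-cases a k b = inj₂ (refl , refl)
MorphFor-cases b k a = inj₂ (refl , refl)
MorphFor-cases b k b = inj₁ (refl , refl)

Prefix∞-pow-++⁻ʳ : ∀ x k R s → Prefix∞ (pow x k ++ R) s → Prefix∞ R (drop∞ k s)
Prefix∞-pow-++⁻ʳ x zero    R s p       = p
Prefix∞-pow-++⁻ʳ x (suc k) R s (e , p) = Prefix∞-pow-++⁻ʳ x k R _ p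

Prefix∞-pow-++-lookup : ∀ x k R s → Prefix∞ (pow x k ++ R) s → ∀ i → i < k → s i ≡ x
Prefix∞-pow-++-lookup x (suc k) R s (e , p) zero    lt       = sym e
Prefix∞-pow-++-lookup x (suc k) R s (e , p) (suc i) (s≤s lt) = Prefix∞-pow-++-lookup x k R _ p i lt

-- For k ≥ 1 the position 2k + 1 of s is x after the block of x and y after the block of y.
MorphFor-blocks-clash : ∀ x k E₁ E₂ s → 1 ≤ k →
  Prefix∞ ((pow x k ++ other x ∷ x ∷ []) ++ (pow x k ++ other x ∷ E₁) ++ []) s →
  Prefix∞ ((pow x k ++ other x ∷ []) ++ (pow x k ++ other x ∷ E₂) ++ []) s → ⊥
MorphFor-blocks-clash x k@(suc k′) E₁ E₂ s _ p₁ p₂ = other-≢ x (trans y≡ (trans (cong s same-position) ≡x))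
  where
  y = other x
  Z₁ = (pow x k ++ y ∷ E₁) ++ []
  Z₂ = (pow x k ++ y ∷ E₂) ++ []
  second-block₁ : Prefix∞ (pow x k ++ y ∷ E₁) (λ i → s (k + suc (suc i)))
  second-block₁ = subst (λ Z → Prefix∞ Z (λ i → s (k + suc (suc i)))) (++-identityʳ _)
    (proj₂ (proj₂ (Prefix∞-pow-++⁻ʳ x k _ s (subst (λ Z → Prefix∞ Z s) (++-assoc (pow x k) (y ∷ x ∷ []) Z₁) p₁))))
  ≡x : s (k + suc (suc k′)) ≡ x
  ≡x = Prefix∞-pow-++-lookup x k (y ∷ E₁) (λ i → s (k + suc (suc i))) second-block₁ k′ ≤-refl
  second-block₂ : Prefix∞ (pow x k ++ y ∷ E₂) (λ i → s (k + suc i))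
  second-block₂ = subst (λ Z → Prefix∞ Z (λ i → s (k + suc i))) (++-identityʳ _)
    (proj₂ (Prefix∞-pow-++⁻ʳ x k _ s (subst (λ Z → Prefix∞ Z s) (++-assoc (pow x k) (y ∷ []) Z₂) p₂)))
  y≡ : y ≡ s (k + suc (k + 0))
  y≡ = proj₁ (Prefix∞-pow-++⁻ʳ x k (y ∷ E₂) (λ i → s (k + suc i)) second-block₂)
  same-position : k + suc (k + 0) ≡ k + suc (suc k′)
  same-position = cong (λ m → k + suc m) (+-identityʳ k)

MorphFor-first-unique : ∀ x k c₁ c₂ d₁ d₂ s → 1 ≤ k →
  Prefix∞ (MorphFor x k c₁ ++ MorphFor x k c₂ ++ []) s →
  Prefix∞ (MorphFor x k d₁ ++ MorphFor x k d₂ ++ []) s → c₁ ≡ d₁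
MorphFor-first-unique x k c₁ c₂ d₁ d₂ s k≥1 p₁ p₂
  with MorphFor-cases x k c₁ | MorphFor-cases x k d₁ | MorphFor-starts x k c₂ | MorphFor-starts x k d₂
... | inj₁ (e₁ , _) | inj₁ (e₂ , _) | _ | _ = trans e₁ (sym e₂)
... | inj₂ (e₁ , _) | inj₂ (e₂ , _) | _ | _ = trans e₁ (sym e₂)
... | inj₁ (_ , f₁) | inj₂ (_ , f₂) | E₁ , g₁ | E₂ , g₂ = ⊥-elim (MorphFor-blocks-clash x k E₁ E₂ s k≥1
        (subst (λ Z → Prefix∞ Z s) (cong₂ (λ A B → A ++ B ++ []) f₁ g₁) p₁)
        (subst (λ Z → Prefix∞ Z s) (cong₂ (λ A B → A ++ B ++ []) f₂ g₂) p₂))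
... | inj₂ (_ , f₁) | inj₁ (_ , f₂) | E₁ , g₁ | E₂ , g₂ = ⊥-elim (MorphFor-blocks-clash x k E₂ E₁ s k≥1
        (subst (λ Z → Prefix∞ Z s) (cong₂ (λ A B → A ++ B ++ []) f₂ g₂) p₂)
        (subst (λ Z → Prefix∞ Z s) (cong₂ (λ A B → A ++ B ++ []) f₁ g₁) p₁))

ImageUnder-injective : ∀ x k {t t′ s} → 1 ≤ k → ImageUnder (MorphFor x k) t s → ImageUnder (MorphFor x k) t′ s → t ≈ t′
ImageUnder-injective x k {t} {t′} {s} k≥1 h h′ = ≈-by-take∞-induction λ n eq →
  subst (λ m → t m ≡ t′ m) (+-identityʳ n)
    (MorphFor-first-unique x k _ _ _ _ _ k≥1 (next-two t n (h (n + 2)))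
      (subst (λ u → Prefix∞ (F (t′ (n + 0)) ++ F (t′ (n + 1)) ++ []) (drop∞ (length (concatMap F u)) s))
        (sym eq) (next-two t′ n (h′ (n + 2)))))
  where
  F = MorphFor x k
  next-two : ∀ u n → Prefix∞ (concatMap F (take∞ (n + 2) u)) s →
    Prefix∞ (F (u (n + 0)) ++ F (u (n + 1)) ++ []) (drop∞ (length (concatMap F (take∞ n u))) s)
  next-two u n p = Prefix∞-++⁻ʳ (concatMap F (take∞ n u)) _ s
    (subst (λ Z → Prefix∞ Z s) (trans (cong (concatMap F) (take∞-+ n 2 u)) (concatMap-++ F (take∞ n u) _)) p)

_≟ₗ_ : (x y : Letter) → Dec (x ≡ y)
a ≟ₗ a = yes refl
a ≟ₗ b = no λ ()
b ≟ₗ a = no λ ()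
b ≟ₗ b = yes refl

FirstRun-search : ∀ v j → (∀ i → i < j → v i ≡ v 0) ⊎ Σ ℕ (FirstRun v)
FirstRun-search v zero = inj₁ λ i ()
FirstRun-search v (suc j) with FirstRun-search v j
... | inj₂ run = inj₂ run
... | inj₁ h with v j ≟ₗ v 0
...   | yes e = inj₁ λ i lt → [ h i , (λ { refl → e }) ]′ (m<1+n⇒m<n∨m≡n lt)
...   | no ne = inj₂ (j , h , ne)

FirstRun-from-≢ : ∀ v j → v j ≢ v 0 → Σ ℕ (FirstRun v)
FirstRun-from-≢ v j ne with FirstRun-search v j
... | inj₂ run = run
... | inj₁ h   = j , h , ne

BothInfinitelyOften⇒other-occurs : ∀ {v} → BothInfinitelyOften v → ∀ c → ∃ λ j → v j ≡ other c
BothInfinitelyOften⇒other-occurs (as , bs) a = let (j , _ , e) = bs 0 in j , e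
BothInfinitelyOften⇒other-occurs (as , bs) b = let (j , _ , e) = as 0 in j , e

BothInfinitelyOften⇒FirstRun : ∀ v → BothInfinitelyOften v → Σ ℕ (FirstRun v)
BothInfinitelyOften⇒FirstRun v both = let (j , vj) = BothInfinitelyOften⇒other-occurs both (v 0) in
  FirstRun-from-≢ v j λ e → other-≢ (v 0) (trans (sym vj) e)

BothInfinitelyOften-drop∞ : ∀ v N → BothInfinitelyOften v → BothInfinitelyOften (drop∞ N v)
BothInfinitelyOften-drop∞ v N (as , bs) = later as , later bs
  where
  later : ∀ {c} → (∀ n → ∃ λ i → n ≤ i × v i ≡ c) → ∀ n → ∃ λ i → n ≤ i × drop∞ N v i ≡ c
  later occ n with occ (N + n)
  ... | i , le , e = i ∸ N , subst (_≤ i ∸ N) (m+n∸m≡n N n) (∸-monoˡ-≤ N le) ,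
                     trans (cong v (m+[n∸m]≡n (≤-trans (m≤m+n N n) le))) e

FirstRun-positive : ∀ {w k} → FirstRun w k → 1 ≤ k
FirstRun-positive {k = zero}  (_ , end) = ⊥-elim (end refl)
FirstRun-positive {k = suc k} _         = s≤s z≤n

FirstRun-unique : ∀ {w k k′} → FirstRun w k → FirstRun w k′ → k ≡ k′
FirstRun-unique {w} {k} {k′} (run , end) (run′ , end′) with <-cmp k k′
... | tri< lt _ _ = ⊥-elim (end (run′ k lt))
... | tri≈ _ e _  = e
... | tri> _ _ gt = ⊥-elim (end′ (run k′ gt))

FirstRun-resp-≈ : ∀ {w w′ k} → w ≈ w′ → FirstRun w k → FirstRun w′ k
FirstRun-resp-≈ e (run , end) = (λ i lt → trans (sym (e i)) (trans (run i lt) (e 0))) ,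
                                 (λ eq → end (trans (e _) (trans eq (sym (e 0)))))

ImageUnder-respˡ-≈ : ∀ {F t t′ s} → t ≈ t′ → ImageUnder F t s → ImageUnder F t′ s
ImageUnder-respˡ-≈ {F} {s = s} e h n = subst (λ W → Prefix∞ (concatMap F W) s) (take∞-cong n e) (h n)

IsD-ψ∞-drop∞ : ∀ {w k} → BothInfinitelyOften w → FirstRun w k → IsD (ψ∞ w) (ψ∞ (drop∞ (suc k) w))
IsD-ψ∞-drop∞ {w} {k} both run = w , k , (both , IsPsi-ψ∞ w) , run ,
  subst (λ x → ImageUnder (MorphFor x k) (ψ∞ (drop∞ (suc k) w)) (ψ∞ w)) (sym (IsPsi-head (IsPsi-ψ∞ w)))
    (ψ∞-ImageUnder w (ψ∞ w) k (IsPsi-ψ∞ w) run)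

IsD⇒IsPsi-drop∞ : ∀ {w s t k} → IsPsi w s → FirstRun w k → IsD s t → IsPsi (drop∞ (suc k) w) t
IsD⇒IsPsi-drop∞ {w} {s} {t} {k} hw run (w′ , k′ , (_ , hw′) , run′ , image) =
  IsPsi-respʳ-≈ (λ i → sym (t≈ i)) (IsPsi-ψ∞ (drop∞ (suc k) w))
  where
  run″ : FirstRun w k′
  run″ = FirstRun-resp-≈ (IsPsi-directive-unique hw′ hw) run′
  k′≡k : k′ ≡ k
  k′≡k = FirstRun-unique run″ run
  image′ : ImageUnder (MorphFor (w 0) k) t s
  image′ = subst₂ (λ x j → ImageUnder (MorphFor x j) t s) (IsPsi-head hw) k′≡k image
  t≈ : t ≈ ψ∞ (drop∞ (suc k) w)
  t≈ = ImageUnder-injective (w 0) k (FirstRun-positive run) image′ (ψ∞-ImageUnder w s k hw run)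

IsD-respʳ-≈ : ∀ {s t t′} → t ≈ t′ → IsD s t → IsD s t′
IsD-respʳ-≈ e (w , k , directive , run , image) = w , k , directive , run , ImageUnder-respˡ-≈ e image

-- Stability and periodicity of the directive word

module RunBlocks (v : InfWord) (both : BothInfinitelyOften v) where

  nextRun : ∀ N → Σ ℕ (FirstRun (drop∞ N v))
  nextRun N = BothInfinitelyOften⇒FirstRun (drop∞ N v) (BothInfinitelyOften-drop∞ v N both)

  -- the directive word of D^p s is drop∞ (runStart p) v
  runStart : ℕ → ℕ
  runStart zero    = 0
  runStart (suc p) = runStart p + suc (proj₁ (nextRun (runStart p)))

  runStart-<-suc : ∀ p → runStart p < runStart (suc p)
  runStart-<-suc p = m<m+n (runStart p) (s≤s z≤n)

  runStart-< : ∀ {p q} → p < q → runStart p < runStart q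
  runStart-< {p} {suc q} lt with m<1+n⇒m<n∨m≡n lt
  ... | inj₁ p<q  = <-trans (runStart-< p<q) (runStart-<-suc q)
  ... | inj₂ refl = runStart-<-suc p

  runStart-≥ : ∀ p → p ≤ runStart p
  runStart-≥ zero    = z≤n
  runStart-≥ (suc p) = ≤-trans (s≤s (runStart-≥ p)) (runStart-<-suc p)

  runStart-injective : ∀ {m n} → m ≢ n → runStart m ≢ runStart n
  runStart-injective {m} {n} m≢n eq with <-cmp m n
  ... | tri< lt _ _ = <-irrefl eq (runStart-< lt)
  ... | tri≈ _ e _  = m≢n e
  ... | tri> _ _ gt = <-irrefl (sym eq) (runStart-< gt)

  D-chain : ∀ p → IsD (ψ∞ (drop∞ (runStart p) v)) (ψ∞ (drop∞ (runStart (suc p)) v))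
  D-chain p = IsD-respʳ-≈ (ψ∞-cong (drop∞-drop∞ N (suc k) v))
    (IsD-ψ∞-drop∞ (BothInfinitelyOften-drop∞ v N both) run)
    where
    N = runStart p
    k = proj₁ (nextRun N)
    run = proj₂ (nextRun N)

  D-chain-unique : ∀ {s} (f : ℕ → InfWord) → IsPsi v s → f 0 ≈ s → (∀ p → IsD (f p) (f (suc p))) →
    ∀ p → IsPsi (drop∞ (runStart p) v) (f p)
  D-chain-unique f hv f₀ steps zero    = IsPsi-respʳ-≈ (λ i → sym (f₀ i)) hv
  D-chain-unique f hv f₀ steps (suc p) = IsPsi-respˡ-≈ (drop∞-drop∞ N (suc (proj₁ (nextRun N))) v)
    (IsD⇒IsPsi-drop∞ (D-chain-unique f hv f₀ steps p) (proj₂ (nextRun N)) (steps p))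
    where
    N = runStart p

<-drop∞-≈⇒UltimatelyPeriodic : ∀ v {A B} → A < B → drop∞ A v ≈ drop∞ B v → UltimatelyPeriodic v
<-drop∞-≈⇒UltimatelyPeriodic v {A} {B} A<B e = take∞ A v , z , (λ ()) , prefix
  where
  L = B ∸ suc A
  V = drop∞ A v
  z = take∞ (suc L) V
  V-periodic : V ≈ drop∞ (length z) V
  V-periodic i = trans (e i) (cong v (begin
    B + i               ≡⟨ cong (_+ i) (sym (trans (+-suc A L) (m+[n∸m]≡n A<B))) ⟩
    A + suc L + i       ≡⟨ +-assoc A (suc L) i ⟩
    A + (suc L + i)     ≡⟨ cong (λ l → A + (l + i)) (sym (length-take∞ (suc L) V)) ⟩
    A + (length z + i)  ∎))
    where open ≡-Reasoning
  powers : ∀ n → Prefix∞ (concat (replicate n z)) V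
  powers zero    = tt
  powers (suc n) = Prefix∞-++⁺ z _ V (Prefix∞-take∞ (suc L) V) (Prefix∞-resp-≈ _ (powers n) V-periodic)
  prefix : ∀ n → Prefix∞ (take∞ A v ++ concat (replicate n z)) v
  prefix n = Prefix∞-++⁺ (take∞ A v) _ v (Prefix∞-take∞ A v)
    (Prefix∞-resp-≈ _ (powers n) (λ i → cong v (cong (_+ i) (sym (length-take∞ A v)))))

≢-drop∞-≈⇒UltimatelyPeriodic : ∀ v {A B} → A ≢ B → drop∞ A v ≈ drop∞ B v → UltimatelyPeriodic v
≢-drop∞-≈⇒UltimatelyPeriodic v {A} {B} A≢B e with <-cmp A B
... | tri< A<B _ _ = <-drop∞-≈⇒UltimatelyPeriodic v A<B e
... | tri≈ _ A≡B _ = ⊥-elim (A≢B A≡B)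
... | tri> _ _ B<A = <-drop∞-≈⇒UltimatelyPeriodic v B<A (λ i → sym (e i))

UltimatelyPeriodic⇒drop∞-periodic : ∀ v → UltimatelyPeriodic v →
  ∃ λ P → ∃ λ L → ∀ N k → P ≤ N → drop∞ N v ≈ drop∞ (N + k * suc L) v
UltimatelyPeriodic⇒drop∞-periodic v (u , []     , z≢[] , prefix) = ⊥-elim (z≢[] refl)
UltimatelyPeriodic⇒drop∞-periodic v (u , c ∷ z′ , _    , prefix) = length u , length z′ , periodic
  where
  z = c ∷ z′
  P = length u
  L = length z
  V = drop∞ P v
  zⁿ : ℕ → Word
  zⁿ n = concat (replicate n z)
  length-zⁿ : ∀ n → n ≤ length (zⁿ n)
  length-zⁿ zero    = z≤n
  length-zⁿ (suc n) = s≤s (≤-trans (length-zⁿ n)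
    (≤-trans (m≤n+m _ (length z′)) (≤-reflexive (sym (length-++ z′ {zⁿ n})))))
  zⁿ-∷ʳ : ∀ n → zⁿ (suc n) ≡ zⁿ n ++ z
  zⁿ-∷ʳ zero    = ++-identityʳ z
  zⁿ-∷ʳ (suc n) = trans (cong (z ++_) (zⁿ-∷ʳ n)) (sym (++-assoc z (zⁿ n) z))
  zⁿ⁺¹-V : ∀ n → Prefix∞ (zⁿ (suc n)) V
  zⁿ⁺¹-V n = Prefix∞-++⁻ʳ u _ v (prefix (suc n))
  zⁿ-V : ∀ n → Prefix∞ (zⁿ n) V
  zⁿ-V n = Prefix∞-++⁻ˡ (zⁿ n) z V (subst (λ W → Prefix∞ W V) (zⁿ-∷ʳ n) (zⁿ⁺¹-V n))
  zⁿ-drop-V : ∀ n → Prefix∞ (zⁿ n) (drop∞ L V)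
  zⁿ-drop-V n = Prefix∞-++⁻ʳ z (zⁿ n) V (zⁿ⁺¹-V n)
  V-period : V ≈ drop∞ L V
  V-period i = trans (sym (Prefix∞⇒nth _ V (zⁿ-V (suc i)) i (length-zⁿ (suc i))))
                     (Prefix∞⇒nth _ (drop∞ L V) (zⁿ-drop-V (suc i)) i (length-zⁿ (suc i)))
  V-periods : ∀ k i → V i ≡ V (k * L + i)
  V-periods zero    i = refl
  V-periods (suc k) i = trans (V-periods k i) (trans (V-period (k * L + i)) (cong V (sym (+-assoc L (k * L) i))))
  periodic : ∀ N k → P ≤ N → drop∞ N v ≈ drop∞ (N + k * L) v
  periodic N k P≤N i = begin
    v (N + i)                   ≡⟨ cong (λ M → v (M + i)) (sym N≡) ⟩
    v (P + d + i)               ≡⟨ cong v (+-assoc P d i) ⟩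
    V (d + i)                   ≡⟨ V-periods k (d + i) ⟩
    V (k * L + (d + i))         ≡⟨ cong v (rearrange P d k L i) ⟩
    v (P + d + k * L + i)       ≡⟨ cong (λ M → v (M + k * L + i)) N≡ ⟩
    v (N + k * L + i)           ∎
    where
    open ≡-Reasoning
    d = N ∸ P
    N≡ : P + d ≡ N
    N≡ = m+[n∸m]≡n P≤N
    rearrange : ∀ p d k l i → p + (k * l + (d + i)) ≡ p + d + k * l + i
    rearrange = solve-∀

drop∞-≈-mod : ∀ v P L → (∀ N k → P ≤ N → drop∞ N v ≈ drop∞ (N + k * suc L) v) →
  ∀ {m n} → P ≤ m → P ≤ n → m % suc L ≡ n % suc L → drop∞ m v ≈ drop∞ n v
drop∞-≈-mod v P L periodic {m} {n} P≤m P≤n m≡n i = begin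
  v (m + i)                       ≡⟨ periodic m (n / M) P≤m i ⟩
  v (m + (n / M) * M + i)         ≡⟨ cong (λ j → v (j + i)) same-sum ⟩
  v (n + (m / M) * M + i)         ≡⟨ sym (periodic n (m / M) P≤n i) ⟩
  v (n + i)                       ∎
  where
  open ≡-Reasoning
  M = suc L
  swap : ∀ r q q′ l → r + q * l + q′ * l ≡ r + q′ * l + q * l
  swap = solve-∀
  same-sum : m + (n / M) * M ≡ n + (m / M) * M
  same-sum = begin
    m + (n / M) * M                        ≡⟨ cong (_+ (n / M) * M) (trans (m≡m%n+[m/n]*n m M) (cong (_+ (m / M) * M) m≡n)) ⟩
    n % M + (m / M) * M + (n / M) * M      ≡⟨ swap (n % M) (m / M) (n / M) M ⟩
    n % M + (n / M) * M + (m / M) * M      ≡⟨ cong (_+ (m / M) * M) (sym (m≡m%n+[m/n]*n n M)) ⟩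
    n + (m / M) * M                        ∎

pigeonhole-% : ∀ (g : ℕ → ℕ) P L → ∃ λ m → ∃ λ n → m < n × P ≤ m × g m % suc L ≡ g n % suc L
pigeonhole-% g P L =
  let (i , j , i<j , same) = pigeonhole (n<1+n (suc L)) residue in
  P + toℕ i , P + toℕ j , +-monoʳ-< P i<j , m≤m+n P (toℕ i) ,
  trans (sym (toℕ-fromℕ< (residue< i))) (trans (cong toℕ same) (toℕ-fromℕ< (residue< j)))
  where
  residue< : ∀ i → g (P + toℕ i) % suc L < suc L
  residue< i = m%n<n (g (P + toℕ i)) (suc L)
  residue : Fin (suc (suc L)) → Fin (suc L)
  residue i = fromℕ< (residue< i)

Stable⇒UltimatelyPeriodic : ∀ v s → Directive v s → Stable s → UltimatelyPeriodic v
Stable⇒UltimatelyPeriodic v s (both , hv) (f , f₀ , steps , m , n , m≢n , fm≈fn) =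
  ≢-drop∞-≈⇒UltimatelyPeriodic v (runStart-injective m≢n)
    (IsPsi-directive-unique (chain m) (IsPsi-respʳ-≈ (λ i → sym (fm≈fn i)) (chain n)))
  where
  open RunBlocks v both
  chain : ∀ p → IsPsi (drop∞ (runStart p) v) (f p)
  chain = D-chain-unique f hv f₀ steps

UltimatelyPeriodic⇒Stable : ∀ v s → Directive v s → UltimatelyPeriodic v → Stable s
UltimatelyPeriodic⇒Stable v s (both , hv) up =
  let (P , L , periodic) = UltimatelyPeriodic⇒drop∞-periodic v up
      (m , n , m<n , P≤m , same-residue) = pigeonhole-% runStart P L
  in f , IsPsi-unique (IsPsi-ψ∞ v) hv , D-chain , m , n , <⇒≢ m<n ,
     ψ∞-cong (drop∞-≈-mod v P L periodic (≤-trans P≤m (runStart-≥ m))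
       (≤-trans P≤m (≤-trans (<⇒≤ m<n) (runStart-≥ n))) same-residue)
  where
  open RunBlocks v both
  f : ℕ → InfWord
  f p = ψ∞ (drop∞ (runStart p) v)

mainTheorem19 : (v s : InfWord) → Directive v s →
    (Stable s ⇔ UltimatelyPeriodic v)
mainTheorem19 v s D = mk⇔ (Stable⇒UltimatelyPeriodic v s D) (UltimatelyPeriodic⇒Stable v s D)
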